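{- Let $(G,\rho)$ be walk-independent. A surjective edge coloring $\delta:E_G\to\{\text{red},\text{blue}\}$ is a Cartesian NAC-coloring if and only if every angle-preserving class of $G$ is monochromatic.
   Context: All graphs are simple, undirected, connected and possibly countably infinite. A placement of $G$ is a map $\rho:V_G\to\mathbb{R}^2$ with $\rho(u)\neq\rho(v)$ for every edge $uv$. A parallelogram placement is an injective placement such that each induced 4-cycle forms a non-degenerate parallelogram (vertices not all collinear). Angle-preserving classes: two edges are in relation $\triangle$ if they lie in a common 3-cycle subgraph of $G$, and in relation $\square$ if they are opposite edges of a 4-cycle subgraph of $G$; the angle-preserving classes are the equivalence classes of the reflexive-transitive closure of $\triangle\cup\square$ on $E_G$. $(G,\rho)$ is walk-independent if $\rho$ is a parallelogram placement and for every angle-preserving class $r$ and every closed walk $C=(u_1,\dots,u_k)$ in $G$ ($u_1=u_k$), $\sum(\rho(u_{i+1})-\rho(u_i))=(0,0)$, summing over all $1\le i<k$ with $u_iu_{i+1}\in r$. A NAC-coloring of $G$ is a surjective map $\delta:E_G\to\{\text{red},\text{blue}\}$ such that for every cycle either all edges have the same color or there are at least two edges of each color. It is Cartesian if no two distinct vertices are connected simultaneously by a red path and by a blue path. -}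

module Defs where

open import Level using (0ℓ) renaming (suc to lsuc)
open import Algebra.Bundles using (CommutativeRing)
open import Data.Nat using (ℕ) renaming (suc to sucℕ)
open import Data.Fin using (Fin; zero; suc; fromℕ; inject₁)
open import Data.Maybe using (Maybe; just; nothing; maybe)
import Data.Maybe as Maybe
open import Data.Product using (Σ; ∃; _×_; _,_)
open import Data.Sum using (_⊎_)
open import Relation.Nullary using (¬_)
open import Data.Empty using (⊥)
open import Relation.Binary.PropositionalEquality using (_≡_; _≢_)
open import Relation.Binary.Construct.Closure.ReflexiveTransitive using (Star)
open import Function using (id)

-- The real numbers, axiomatised as a complete ordered field
-- (any model is isomorphic to ℝ).  Equality is the setoid equality ≈.

record CompleteOrderedField : Set₁ where
  field
    ℝring : CommutativeRing 0ℓ 0ℓ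
  open CommutativeRing ℝring public
  field
    _<_          : Carrier → Carrier → Set
    <-resp-≈     : ∀ {x x′ y y′} → x ≈ x′ → y ≈ y′ → x < y → x′ < y′
    <-irrefl     : ∀ {x y} → x ≈ y → ¬ (x < y)
    <-trans      : ∀ {x y z} → x < y → y < z → x < z
    <-trichotomy : ∀ x y → (x < y) ⊎ (x ≈ y) ⊎ (y < x)
    +-mono-<     : ∀ {x y} z → x < y → (x + z) < (y + z)
    *-pos        : ∀ {x y} → 0# < x → 0# < y → 0# < (x * y)
    0<1          : 0# < 1#
    inverse      : ∀ x → ¬ (x ≈ 0#) → Σ Carrier λ y → (x * y) ≈ 1#

  _≤_ : Carrier → Carrier → Set
  x ≤ y = (x < y) ⊎ (x ≈ y)

  IsUpperBound : (Carrier → Set) → Carrier → Set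
  IsUpperBound S b = ∀ x → S x → x ≤ b

  IsLeastUpperBound : (Carrier → Set) → Carrier → Set
  IsLeastUpperBound S s = IsUpperBound S s × (∀ b → IsUpperBound S b → s ≤ b)

  field
    complete : (S : Carrier → Set) → ∃ S → ∃ (IsUpperBound S) → ∃ (IsLeastUpperBound S)

module Plane (R : CompleteOrderedField) where
  open CompleteOrderedField R

  Pt : Set
  Pt = Carrier × Carrier

  _≈²_ : Pt → Pt → Set
  (x , y) ≈² (x′ , y′) = (x ≈ x′) × (y ≈ y′)

  _+²_ : Pt → Pt → Pt
  (x , y) +² (x′ , y′) = (x + x′) , (y + y′)

  _-²_ : Pt → Pt → Pt
  (x , y) -² (x′ , y′) = (x - x′) , (y - y′)

  0² : Pt
  0² = 0# , 0#

  Collinear : Pt → Pt → Pt → Set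
  Collinear (px , py) (qx , qy) (rx , ry) =
    ((qx - px) * (ry - py)) ≈ ((qy - py) * (rx - px))

  AllCollinear : Pt → Pt → Pt → Pt → Set
  AllCollinear a b c d =
    Collinear a b c × Collinear a b d × Collinear a c d × Collinear b c d

data WalkIn {V : Set} (Adj : V → V → Set) (u : V) : V → Set where
  []  : WalkIn Adj u u
  _▸_ : ∀ {v w} → WalkIn Adj u v → Adj v w → WalkIn Adj u w

record Graph : Set₁ where
  field
    V         : Set
    Adj       : V → V → Set
    Adj-sym   : ∀ {u v} → Adj u v → Adj v u
    Adj-irr   : ∀ {u} → ¬ Adj u u
    enc       : V → ℕ
    enc-inj   : ∀ {u v} → enc u ≡ enc v → u ≡ v

    connected : ∀ u v → WalkIn Adj u v

succ? : ∀ {m} → Fin (sucℕ m) → Maybe (Fin (sucℕ m))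
succ? {ℕ.zero}   zero    = nothing
succ? {sucℕ m}   zero    = just (suc zero)
succ? {sucℕ m}   (suc i) = Maybe.map suc (succ? {m} i)

next : ∀ {m} → Fin (sucℕ m) → Fin (sucℕ m)
next i = maybe id zero (succ? i)

data Color : Set where
  red blue : Color

module GraphNotions (G : Graph) where
  open Graph G public

  Walk : V → V → Set
  Walk = WalkIn Adj

  record Edge : Set where
    constructor edge
    field
      src : V
      tgt : V
      adj : Adj src tgt
  open Edge public

  EdgeIs : Edge → V → V → Set
  EdgeIs e a b = (src e ≡ a × tgt e ≡ b) ⊎ (src e ≡ b × tgt e ≡ a)

  SameEdge : Edge → Edge → Set
  SameEdge e f = EdgeIs f (src e) (tgt e)

  Tri : Edge → Edge → Set
  Tri e f = Σ V λ a → Σ V λ b → Σ V λ c →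
    Adj a b × Adj b c × Adj c a ×
    (EdgeIs e a b ⊎ EdgeIs e b c ⊎ EdgeIs e c a) ×
    (EdgeIs f a b ⊎ EdgeIs f b c ⊎ EdgeIs f c a)

  Sq : Edge → Edge → Set
  Sq e f = Σ V λ a → Σ V λ b → Σ V λ c → Σ V λ d →
    a ≢ b × a ≢ c × a ≢ d × b ≢ c × b ≢ d × c ≢ d ×
    Adj a b × Adj b c × Adj c d × Adj d a ×
    ((EdgeIs e a b × EdgeIs f c d) ⊎ (EdgeIs e b c × EdgeIs f d a))

  -- edges are unordered, so SameEdge is included in the base relation
  AngleStep : Edge → Edge → Set
  AngleStep e f = SameEdge e f ⊎ Tri e f ⊎ Sq e f

  SameClass : Edge → Edge → Set
  SameClass = Star AngleStep

  WellDefinedColoring : (Edge → Color) → Set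
  WellDefinedColoring δ = ∀ e f → SameEdge e f → δ e ≡ δ f

  SurjectiveColoring : (Edge → Color) → Set
  SurjectiveColoring δ = (∃ λ e → δ e ≡ red) × (∃ λ e → δ e ≡ blue)

  record Cycle : Set where
    field
      len-3   : ℕ
      vtx     : Fin (sucℕ (sucℕ (sucℕ len-3))) → V
      vtx-inj : ∀ i j → vtx i ≡ vtx j → i ≡ j
      cadj    : ∀ i → Adj (vtx i) (vtx (next i))

    cedge : Fin (sucℕ (sucℕ (sucℕ len-3))) → Edge
    cedge i = edge (vtx i) (vtx (next i)) (cadj i)

  IsNAC : (Edge → Color) → Set
  IsNAC δ = SurjectiveColoring δ × ∀ (C : Cycle) → let open Cycle C in
      (∀ i j → δ (cedge i) ≡ δ (cedge j))
    ⊎ ((Σ _ λ i → Σ _ λ j → i ≢ j × δ (cedge i) ≡ red  × δ (cedge j) ≡ red) ×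
       (Σ _ λ i → Σ _ λ j → i ≢ j × δ (cedge i) ≡ blue × δ (cedge j) ≡ blue))

  record MonoPath (δ : Edge → Color) (c : Color) (u v : V) : Set where
    field
      len     : ℕ
      pvtx    : Fin (sucℕ len) → V
      pvtx-inj : ∀ i j → pvtx i ≡ pvtx j → i ≡ j
      start   : pvtx zero ≡ u
      end     : pvtx (fromℕ len) ≡ v
      padj    : ∀ (i : Fin len) → Adj (pvtx (inject₁ i)) (pvtx (suc i))
      pcolor  : ∀ (i : Fin len) → δ (edge (pvtx (inject₁ i)) (pvtx (suc i)) (padj i)) ≡ c

  IsCartesian : (Edge → Color) → Set
  IsCartesian δ = ∀ u v → u ≢ v → MonoPath δ red u v → MonoPath δ blue u v → ⊥

  IsCartesianNAC : (Edge → Color) → Set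
  IsCartesianNAC δ = IsNAC δ × IsCartesian δ

  AllClassesMonochromatic : (Edge → Color) → Set
  AllClassesMonochromatic δ = ∀ e f → SameClass e f → δ e ≡ δ f

  module Placements (R : CompleteOrderedField) where
    open CompleteOrderedField R
    open Plane R public

    IsParallelogramPlacement : (V → Pt) → Set
    IsParallelogramPlacement ρ =
      (∀ u v → ρ u ≈² ρ v → u ≡ v) ×
      (∀ a b c d → a ≢ c → b ≢ d →
         Adj a b → Adj b c → Adj c d → Adj d a → ¬ Adj a c → ¬ Adj b d →
         ((ρ b -² ρ a) ≈² (ρ c -² ρ d)) × ¬ AllCollinear (ρ a) (ρ b) (ρ c) (ρ d))

    data ClassSum (ρ : V → Pt) (e : Edge) {u : V} : ∀ {v} → Walk u v → Pt → Set where
      nil  : ClassSum ρ e [] 0²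
      yes  : ∀ {v w} {W : Walk u v} {s} (a : Adj v w) → ClassSum ρ e W s →
             SameClass e (edge v w a) → ClassSum ρ e (W ▸ a) (s +² (ρ w -² ρ v))
      no   : ∀ {v w} {W : Walk u v} {s} (a : Adj v w) → ClassSum ρ e W s →
             ¬ SameClass e (edge v w a) → ClassSum ρ e (W ▸ a) s

    IsWalkIndependent : (V → Pt) → Set
    IsWalkIndependent ρ = IsParallelogramPlacement ρ ×
      (∀ (e : Edge) (u : V) (W : Walk u u) (s : Pt) → ClassSum ρ e W s → s ≈² 0²)

{-# OPTIONS --safe #-}
-- (⇒) A triangle cannot carry two edges of each colour, so a NAC-colouring makes it
-- monochromatic.  If opposite edges of a 4-cycle differ in colour, then either one edge is
-- alone in its colour (not NAC) or the cycle splits into a red and a blue path between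
-- opposite corners (not Cartesian).  Hence △ and □ preserve colours.
--
-- (⇐) Let every class be monochromatic.  An edge alone in its colour on a cycle would be
-- alone in its class there, and walk independence around the cycle would make its
-- displacement vanish, contradicting injectivity of ρ.  If a red and a blue path joined
-- u ≠ v, every class met by the red path avoids the blue one, so the closed walk "red path,
-- then blue path backwards" shows that each class contributes 0 to the displacement
-- ρ v - ρ u of the red path; summing over its finitely many classes gives ρ u = ρ v.
module Submission where

open import Defs
open import Algebra.Bundles using (AbelianGroup; CommutativeMonoid)
import Algebra.Construct.DirectProduct as DirectProduct
import Algebra.Properties.AbelianGroup as AbelianGroupProperties
open import Data.Empty using (⊥)
open import Data.Fin using (Fin; zero; suc; fromℕ; inject₁; punchIn; #_; _≟_)
open import Data.Fin.Properties
  using (any?; all?; ¬∀⟶∃¬; punchInᵢ≢i; fromℕ≢inject₁; inject₁-injective)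
open import Data.List using (List; []; _∷_; _++_; length)
open import Data.List.Membership.Propositional using (_∈_)
open import Data.List.Relation.Unary.All as All using (All; []; _∷_)
open import Data.List.Relation.Unary.All.Properties using (++⁺)
open import Data.List.Relation.Unary.Any using (here; there)
import Data.Maybe as Maybe
open import Data.Maybe using (just; nothing; maybe)
open import Data.Nat as ℕ using (ℕ; _+_; _≤_; z≤n; s≤s)
open import Data.Nat.Properties using (≤-refl; ≤-trans; m≤n⇒m≤1+n)
open import Data.Product using (Σ; ∃; ∃₂; _×_; _,_; proj₁; proj₂; map₁)
open import Data.Sum using (_⊎_; inj₁; inj₂)
open import Data.Vec using ([]; _∷_; lookup)
open import Data.Vec.Relation.Unary.All using ([]; _∷_)
open import Data.Vec.Relation.Unary.AllPairs using ([]; _∷_)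
open import Data.Vec.Relation.Unary.Unique.Propositional.Properties using (lookup-injective)
open import Function using (id; _∘_; case_of_)
open import Level using (_⊔_)
open import Relation.Binary.Core using (Rel)
open import Relation.Binary.Structures using (IsEquivalence)
import Relation.Binary.Construct.Closure.ReflexiveTransitive as Star
open Star using (_◅◅_)
open import Relation.Binary.PropositionalEquality
  using (_≡_; _≢_; refl; sym; trans; cong; subst; subst₂; module ≡-Reasoning)
open import Relation.Nullary using (¬_; Dec; yes; no; contradiction)
open import Relation.Nullary.Decidable using (¬?; _×-dec_; decidable-stable; ¬¬-excluded-middle)
open import Relation.Unary using (Pred)

_≟ᶜ_ : (c c′ : Color) → Dec (c ≡ c′)
red  ≟ᶜ red  = yes refl
red  ≟ᶜ blue = no λ ()
blue ≟ᶜ red  = no λ ()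
blue ≟ᶜ blue = yes refl

colour-≡-either : ∀ {c c′ : Color} → c ≢ c′ → ∀ d → d ≡ c ⊎ d ≡ c′
colour-≡-either {red}  {red}  c≢c′ _    = contradiction refl c≢c′
colour-≡-either {blue} {blue} c≢c′ _    = contradiction refl c≢c′
colour-≡-either {red}  {blue} _    red  = inj₁ refl
colour-≡-either {red}  {blue} _    blue = inj₂ refl
colour-≡-either {blue} {red}  _    red  = inj₂ refl
colour-≡-either {blue} {red}  _    blue = inj₁ refl

module _ {n : ℕ} (f : Fin n → Color) where

  Lonely : Fin n → Set
  Lonely i = ∀ j → j ≢ i → f j ≢ f i

  TwoOf : Color → Set
  TwoOf c = Σ (Fin n) λ i → Σ (Fin n) λ j → i ≢ j × f i ≡ c × f j ≡ c

  NACPattern : Set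
  NACPattern = (∀ i j → f i ≡ f j) ⊎ (TwoOf red × TwoOf blue)

  twoOf⇒¬lonely : ∀ {c i} → TwoOf c → f i ≡ c → ¬ Lonely i
  twoOf⇒¬lonely {i = i} (j , k , j≢k , fj≡c , fk≡c) fi≡c lonely with j ≟ i
  ... | yes refl = lonely k (j≢k ∘ sym) (trans fk≡c (sym fi≡c))
  ... | no j≢i   = lonely j j≢i (trans fj≡c (sym fi≡c))

  ¬lonely⇒twoOf : ∀ {c i} → f i ≡ c → ¬ Lonely i → TwoOf c
  ¬lonely⇒twoOf {i = i} fi≡c ¬lonely with any? (λ j → ¬? (j ≟ i) ×-dec (f j ≟ᶜ f i))
  ... | yes (j , j≢i , fj≡fi) = j , i , j≢i , trans fj≡fi fi≡c , fi≡c
  ... | no ∄j = contradiction (λ j j≢i fj≡fi → ∄j (j , j≢i , fj≡fi)) ¬lonely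

twoOf-both : ∀ {n} {f : Fin n → Color} {c c′} → c ≢ c′ → TwoOf f c → TwoOf f c′ →
             TwoOf f red × TwoOf f blue
twoOf-both {c = red}  {red}  c≢c′ _  _  = contradiction refl c≢c′
twoOf-both {c = blue} {blue} c≢c′ _  _  = contradiction refl c≢c′
twoOf-both {c = red}  {blue} _    rs bs = rs , bs
twoOf-both {c = blue} {red}  _    bs rs = rs , bs

lonely⇒¬nacPattern : ∀ {n} (f : Fin (2 + n) → Color) i → Lonely f i → ¬ NACPattern f
lonely⇒¬nacPattern f i lonely (inj₁ constant) =
  lonely (punchIn i zero) (punchInᵢ≢i i zero) (constant _ i)
lonely⇒¬nacPattern f i lonely (inj₂ (reds , blues)) = refute (f i) refl
  where
  refute : ∀ c → f i ≡ c → ⊥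
  refute red  fi≡red  = twoOf⇒¬lonely f reds  fi≡red  lonely
  refute blue fi≡blue = twoOf⇒¬lonely f blues fi≡blue lonely

¬lonely⇒nacPattern : ∀ {n} (f : Fin (1 + n) → Color) → (∀ i → ¬ Lonely f i) → NACPattern f
¬lonely⇒nacPattern f ¬lonely with all? (λ i → f i ≟ᶜ f zero)
... | yes constant = inj₁ λ i j → trans (constant i) (sym (constant j))
... | no ¬constant with ¬∀⟶∃¬ _ _ (λ i → f i ≟ᶜ f zero) ¬constant
...   | i , fi≢f0 = inj₂ (twoOf-both fi≢f0 (¬lonely⇒twoOf f refl (¬lonely i))
                                           (¬lonely⇒twoOf f refl (¬lonely zero)))

lonely-in-triangle : (f : Fin 3 → Color) → f (# 0) ≢ f (# 1) → ∃ (Lonely f)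
lonely-in-triangle f f₀≢f₁ with colour-≡-either f₀≢f₁ (f (# 2))
... | inj₁ f₂≡f₀ = # 1 , λ where
  zero                _   → f₀≢f₁
  (suc zero)          1≢1 → contradiction refl 1≢1
  (suc (suc zero))    _   → f₀≢f₁ ∘ trans (sym f₂≡f₀)
... | inj₂ f₂≡f₁ = # 0 , λ where
  zero                0≢0 → contradiction refl 0≢0
  (suc zero)          _   → f₀≢f₁ ∘ sym
  (suc (suc zero))    _   → λ f₂≡f₀ → f₀≢f₁ (trans (sym f₂≡f₀) f₂≡f₁)

square-colouring : (f : Fin 4 → Color) → f (# 0) ≢ f (# 2) →
                   ∃ (Lonely f)
                   ⊎ (f (# 0) ≡ f (# 1) × f (# 2) ≡ f (# 3))
                   ⊎ (f (# 1) ≡ f (# 2) × f (# 3) ≡ f (# 0))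
square-colouring f f₀≢f₂ with colour-≡-either f₀≢f₂ (f (# 1)) | colour-≡-either f₀≢f₂ (f (# 3))
... | inj₁ f₁≡f₀ | inj₂ f₃≡f₂ = inj₂ (inj₁ (sym f₁≡f₀ , sym f₃≡f₂))
... | inj₂ f₁≡f₂ | inj₁ f₃≡f₀ = inj₂ (inj₂ (f₁≡f₂ , f₃≡f₀))
... | inj₁ f₁≡f₀ | inj₁ f₃≡f₀ = inj₁ (# 2 , λ where
  zero                   _   → f₀≢f₂
  (suc zero)             _   → f₀≢f₂ ∘ trans (sym f₁≡f₀)
  (suc (suc zero))       2≢2 → contradiction refl 2≢2
  (suc (suc (suc zero))) _   → f₀≢f₂ ∘ trans (sym f₃≡f₀))
... | inj₂ f₁≡f₂ | inj₂ f₃≡f₂ = inj₁ (# 0 , λ where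
  zero                   0≢0 → contradiction refl 0≢0
  (suc zero)             _   → λ f₁≡f₀ → f₀≢f₂ (trans (sym f₁≡f₀) f₁≡f₂)
  (suc (suc zero))       _   → f₀≢f₂ ∘ sym
  (suc (suc (suc zero))) _   → λ f₃≡f₀ → f₀≢f₂ (trans (sym f₃≡f₀) f₃≡f₂))

module FilteredSums {c ℓ a} (M : CommutativeMonoid c ℓ) {E : Set a}
                    (w : E → CommutativeMonoid.Carrier M) where
  open CommutativeMonoid M
    using (Carrier; _≈_; _∙_; ε; setoid; ∙-cong; ∙-congˡ; ∙-congʳ; assoc; comm; identityˡ)
    renaming (refl to ≈-refl; sym to ≈-sym)
  open import Relation.Binary.Reasoning.Setoid setoid

  total : List E → Carrier
  total []       = ε
  total (x ∷ xs) = total xs ∙ w x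

  data FilteredSum {p} (P : Pred E p) : List E → Carrier → Set (a ⊔ c ⊔ p) where
    []   : FilteredSum P [] ε
    keep : ∀ {x xs s} → P x   → FilteredSum P xs s → FilteredSum P (x ∷ xs) (s ∙ w x)
    skip : ∀ {x xs s} → ¬ P x → FilteredSum P xs s → FilteredSum P (x ∷ xs) s

  filteredSum-skip-++ : ∀ {p} {P : Pred E p} {xs ys s} →
                        All (¬_ ∘ P) ys → FilteredSum P xs s → FilteredSum P (ys ++ xs) s
  filteredSum-skip-++ []          sum = sum
  filteredSum-skip-++ (¬Py ∷ ¬Ps) sum = skip ¬Py (filteredSum-skip-++ ¬Ps sum)

  data Split {p} (P : Pred E p) : List E → List E → List E → Set (a ⊔ p) where
    []   : Split P [] [] []
    keep : ∀ {x xs ys zs} → P x   → Split P xs ys zs → Split P (x ∷ xs) (x ∷ ys) zs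
    skip : ∀ {x xs ys zs} → ¬ P x → Split P xs ys zs → Split P (x ∷ xs) ys (x ∷ zs)

  module _ {p} {P : Pred E p} where

    ¬¬split : ∀ xs → ¬ ¬ ∃₂ (Split P xs)
    ¬¬split []       k = k ([] , [] , [])
    ¬¬split (x ∷ xs) k = ¬¬split xs λ (ys , zs , split) → ¬¬-excluded-middle λ where
      (yes Px) → k (x ∷ ys , zs , keep Px split)
      (no ¬Px) → k (ys , x ∷ zs , skip ¬Px split)

    split-total : ∀ {xs ys zs} → Split P xs ys zs → total xs ≈ total ys ∙ total zs
    split-total [] = ≈-sym (identityˡ ε)
    split-total {x ∷ xs} {x ∷ ys} {zs} (keep _ split) = begin
      total xs ∙ w x              ≈⟨ ∙-congʳ (split-total split) ⟩
      total ys ∙ total zs ∙ w x   ≈⟨ assoc _ _ _ ⟩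
      total ys ∙ (total zs ∙ w x) ≈⟨ ∙-congˡ (comm _ _) ⟩
      total ys ∙ (w x ∙ total zs) ≈⟨ assoc _ _ _ ⟨
      total ys ∙ w x ∙ total zs   ∎
    split-total {x ∷ xs} {ys} {x ∷ zs} (skip _ split) = begin
      total xs ∙ w x              ≈⟨ ∙-congʳ (split-total split) ⟩
      total ys ∙ total zs ∙ w x   ≈⟨ assoc _ _ _ ⟩
      total ys ∙ (total zs ∙ w x) ∎

    split-filteredSum : ∀ {xs ys zs} → Split P xs ys zs → FilteredSum P xs (total ys)
    split-filteredSum []               = []
    split-filteredSum (keep Px split)  = keep Px (split-filteredSum split)
    split-filteredSum (skip ¬Px split) = skip ¬Px (split-filteredSum split)

    split-rejected : ∀ {xs ys zs z} → Split P xs ys zs → z ∈ zs → z ∈ xs × ¬ P z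
    split-rejected (keep _ split)   z∈zs         = map₁ there (split-rejected split z∈zs)
    split-rejected (skip ¬Px split) (here refl)  = here refl , ¬Px
    split-rejected (skip _ split)   (there z∈zs) = map₁ there (split-rejected split z∈zs)

    split-filteredSum-rejected : ∀ {q} {Q : Pred E q} {xs ys zs s} → (∀ {y} → P y → ¬ Q y) →
                                 Split P xs ys zs → FilteredSum Q zs s → FilteredSum Q xs s
    split-filteredSum-rejected P⇒¬Q []              []             = []
    split-filteredSum-rejected P⇒¬Q (keep Px split) sum            =
      skip (P⇒¬Q Px) (split-filteredSum-rejected P⇒¬Q split sum)
    split-filteredSum-rejected P⇒¬Q (skip _ split)  (keep Qx sum)  =
      keep Qx (split-filteredSum-rejected P⇒¬Q split sum)
    split-filteredSum-rejected P⇒¬Q (skip _ split)  (skip ¬Qx sum) =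
      skip ¬Qx (split-filteredSum-rejected P⇒¬Q split sum)

    split-length : ∀ {xs ys zs} → Split P xs ys zs → length zs ≤ length xs
    split-length []             = z≤n
    split-length (keep _ split) = m≤n⇒m≤1+n (split-length split)
    split-length (skip _ split) = s≤s (split-length split)

  module _ {r} {_~_ : Rel E r} (~-isEquivalence : IsEquivalence _~_) where
    open IsEquivalence ~-isEquivalence renaming (refl to ~-refl; sym to ~-sym; trans to ~-trans)

    ClassSumsVanish : List E → Set (a ⊔ c ⊔ ℓ ⊔ r)
    ClassSumsVanish xs = ∀ {x s} → x ∈ xs → FilteredSum (x ~_) xs s → s ≈ ε

    -- Classes are not decidable, so the class of the head is split off only under ¬ ¬.
    classSumsVanish⇒¬¬total≈ε : ∀ xs → ClassSumsVanish xs → ¬ ¬ (total xs ≈ ε)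
    classSumsVanish⇒¬¬total≈ε xs = go (length xs) xs ≤-refl
      where
      go : ∀ n xs → length xs ≤ n → ClassSumsVanish xs → ¬ ¬ (total xs ≈ ε)
      go _         []       _            _      k = k ≈-refl
      go (ℕ.suc n) (x ∷ xs) (s≤s |xs|≤n) vanish k = ¬¬split xs λ (ys , zs , split) →
        let split′ = keep ~-refl split in
        go n zs (≤-trans (split-length split) |xs|≤n)
          (λ z∈zs sum →
             let z∈xs , x≁z = split-rejected split′ z∈zs
             in  vanish z∈xs (split-filteredSum-rejected
                                (λ x~y z~y → x≁z (~-trans x~y (~-sym z~y))) split′ sum))
          λ total-zs≈ε → k (begin
            total (x ∷ xs)            ≈⟨ split-total split′ ⟩
            total (x ∷ ys) ∙ total zs ≈⟨ ∙-cong (vanish (here refl) (split-filteredSum split′)) total-zs≈ε ⟩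
            ε ∙ ε                     ≈⟨ identityˡ ε ⟩
            ε                         ∎)

telescope : ∀ {c ℓ} (G : AbelianGroup c ℓ) → let open AbelianGroup G in
            ∀ x y z → (y ∙ x ⁻¹) ∙ (z ∙ y ⁻¹) ≈ z ∙ x ⁻¹
telescope G x y z = begin
  (y ∙ x ⁻¹) ∙ (z ∙ y ⁻¹) ≈⟨ comm _ _ ⟩
  (z ∙ y ⁻¹) ∙ (y ∙ x ⁻¹) ≈⟨ assoc _ _ _ ⟩
  z ∙ (y ⁻¹ ∙ (y ∙ x ⁻¹)) ≈⟨ ∙-congˡ (assoc _ _ _) ⟨
  z ∙ ((y ⁻¹ ∙ y) ∙ x ⁻¹) ≈⟨ ∙-congˡ (∙-congʳ (inverseˡ y)) ⟩
  z ∙ (ε ∙ x ⁻¹)          ≈⟨ ∙-congˡ (identityˡ _) ⟩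
  z ∙ x ⁻¹                ∎
  where
  open AbelianGroup G
  open import Relation.Binary.Reasoning.Setoid setoid

succ?-inject₁ : ∀ {m} (i : Fin m) → succ? (inject₁ i) ≡ just (suc i)
succ?-inject₁ {ℕ.suc m} zero    = refl
succ?-inject₁ {ℕ.suc m} (suc i) = cong (Maybe.map suc) (succ?-inject₁ i)

succ?-fromℕ : ∀ m → succ? (fromℕ m) ≡ nothing
succ?-fromℕ ℕ.zero    = refl
succ?-fromℕ (ℕ.suc m) = cong (Maybe.map suc) (succ?-fromℕ m)

next-inject₁ : ∀ {m} (i : Fin m) → next (inject₁ i) ≡ suc i
next-inject₁ i = cong (maybe id zero) (succ?-inject₁ i)

next-fromℕ : ∀ m → next (fromℕ m) ≡ zero
next-fromℕ m = cong (maybe id zero) (succ?-fromℕ m)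

data LastOrInject : ∀ {n} → Fin (1 + n) → Set where
  last   : ∀ {n} → LastOrInject (fromℕ n)
  inject : ∀ {n} (j : Fin n) → LastOrInject (inject₁ j)

lastOrInject : ∀ {n} (i : Fin (1 + n)) → LastOrInject i
lastOrInject {ℕ.zero}  zero    = last
lastOrInject {ℕ.suc n} zero    = inject zero
lastOrInject {ℕ.suc n} (suc i) with lastOrInject i
... | last     = last
... | inject j = inject (suc j)

module Graphs (G : Graph) where
  open GraphNotions G

  edges : ∀ {u v} → Walk u v → List Edge
  edges []                = []
  edges (_▸_ {v} {w} W a) = edge v w a ∷ edges W

  _++ᵂ_ : ∀ {u v w} → Walk u v → Walk v w → Walk u w
  W ++ᵂ []       = W
  W ++ᵂ (W′ ▸ a) = (W ++ᵂ W′) ▸ a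

  edges-++ᵂ : ∀ {u v w} (W : Walk u v) (W′ : Walk v w) → edges (W ++ᵂ W′) ≡ edges W′ ++ edges W
  edges-++ᵂ W []       = refl
  edges-++ᵂ W (W′ ▸ a) = cong (_ ∷_) (edges-++ᵂ W W′)

  reverseᵂ : ∀ {u v} → Walk u v → Walk v u
  reverseᵂ []      = []
  reverseᵂ (W ▸ a) = ([] ▸ Adj-sym a) ++ᵂ reverseᵂ W

  All-reverseᵂ : ∀ {q} {Q : Pred Edge q} →
                 (∀ {v w} (a : Adj v w) → Q (edge v w a) → Q (edge w v (Adj-sym a))) →
                 ∀ {u v} (W : Walk u v) → All Q (edges W) → All Q (edges (reverseᵂ W))
  All-reverseᵂ Q-flip []      []        = []
  All-reverseᵂ Q-flip (W ▸ a) (Qa ∷ QW) =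
    subst (All _) (sym (edges-++ᵂ ([] ▸ Adj-sym a) (reverseᵂ W)))
          (++⁺ (All-reverseᵂ Q-flip W QW) (Q-flip a Qa ∷ []))

  pathWalk : ∀ {n} (f : Fin (1 + n) → V) → (∀ i → Adj (f (inject₁ i)) (f (suc i))) →
             Walk (f zero) (f (fromℕ n))
  pathWalk {ℕ.zero}  f adj = []
  pathWalk {ℕ.suc n} f adj = pathWalk (f ∘ inject₁) (adj ∘ inject₁) ▸ adj (fromℕ n)

  pathEdge : ∀ {n} (f : Fin (1 + n) → V) → (∀ i → Adj (f (inject₁ i)) (f (suc i))) → Fin n → Edge
  pathEdge f adj i = edge (f (inject₁ i)) (f (suc i)) (adj i)

  All-pathWalk : ∀ {q} {Q : Pred Edge q} {n} (f : Fin (1 + n) → V) adj →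
                 (∀ i → Q (pathEdge f adj i)) → All Q (edges (pathWalk f adj))
  All-pathWalk {n = ℕ.zero}  f adj Q-path = []
  All-pathWalk {n = ℕ.suc n} f adj Q-path =
    Q-path (fromℕ n) ∷ All-pathWalk (f ∘ inject₁) (adj ∘ inject₁) (Q-path ∘ inject₁)

  sameEdge-sym : ∀ {e f} → SameEdge e f → SameEdge f e
  sameEdge-sym (inj₁ (s≡s , t≡t)) = inj₁ (sym s≡s , sym t≡t)
  sameEdge-sym (inj₂ (s≡t , t≡s)) = inj₂ (sym t≡s , sym s≡t)

  angleStep-sym : ∀ {e f} → AngleStep e f → AngleStep f e
  angleStep-sym {e} {f} (inj₁ same) = inj₁ (sameEdge-sym {e} {f} same)
  angleStep-sym (inj₂ (inj₁ (a , b , c , p , q , r , e∈abc , f∈abc))) =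
    inj₂ (inj₁ (a , b , c , p , q , r , f∈abc , e∈abc))
  angleStep-sym (inj₂ (inj₂ (a , b , c , d , a≢b , a≢c , a≢d , b≢c , b≢d , c≢d , p , q , r , s , opp))) =
    inj₂ (inj₂ (c , d , a , b , c≢d , a≢c ∘ sym , b≢c ∘ sym , a≢d ∘ sym , b≢d ∘ sym , a≢b ,
                r , s , p , q , swap opp))
    where
    swap : ∀ {A B C D : Set} → (A × B) ⊎ (C × D) → (B × A) ⊎ (D × C)
    swap (inj₁ (x , y)) = inj₁ (y , x)
    swap (inj₂ (x , y)) = inj₂ (y , x)

  sameClass-isEquivalence : IsEquivalence SameClass
  sameClass-isEquivalence = record
    { refl  = Star.ε
    ; sym   = Star.reverse λ {e} {f} → angleStep-sym {e} {f}
    ; trans = _◅◅_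
    }

  adj⇒≢ : ∀ {a b} → Adj a b → a ≢ b
  adj⇒≢ p refl = Adj-irr p

  triangle : ∀ {a b c} → Adj a b → Adj b c → Adj c a → Cycle
  triangle {a} {b} {c} p q r = record
    { len-3   = 0
    ; vtx     = lookup (a ∷ b ∷ c ∷ [])
    ; vtx-inj = lookup-injective ((adj⇒≢ p ∷ adj⇒≢ r ∘ sym ∷ []) ∷ (adj⇒≢ q ∷ []) ∷ [] ∷ [])
    ; cadj    = λ where
        zero             → p
        (suc zero)       → q
        (suc (suc zero)) → r
    }

  square : ∀ {a b c d} → a ≢ c → b ≢ d → Adj a b → Adj b c → Adj c d → Adj d a → Cycle
  square {a} {b} {c} {d} a≢c b≢d p q r s = record
    { len-3   = 1
    ; vtx     = lookup (a ∷ b ∷ c ∷ d ∷ [])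
    ; vtx-inj = lookup-injective
        ((adj⇒≢ p ∷ a≢c ∷ adj⇒≢ s ∘ sym ∷ []) ∷ (adj⇒≢ q ∷ b≢d ∷ []) ∷ (adj⇒≢ r ∷ []) ∷ [] ∷ [])
    ; cadj    = λ where
        zero                   → p
        (suc zero)             → q
        (suc (suc zero))       → r
        (suc (suc (suc zero))) → s
    }

  module CyclePath (C : Cycle) where
    open Cycle C

    -- The cycle unrolled into a path that returns to its starting vertex.
    position : Fin (1 + (3 + len-3)) → V
    position zero    = vtx zero
    position (suc k) = vtx (next k)

    position-inject₁ : ∀ k → position (inject₁ k) ≡ vtx k
    position-inject₁ zero    = refl
    position-inject₁ (suc k) = cong vtx (next-inject₁ k)

    step : ∀ k → Adj (position (inject₁ k)) (position (suc k))
    step k = subst (λ x → Adj x (vtx (next k))) (sym (position-inject₁ k)) (cadj k)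

    position-closes : position (fromℕ _) ≡ position zero
    position-closes = cong vtx (next-fromℕ _)

    cedge≅step : ∀ k → SameEdge (cedge k) (pathEdge position step k)
    cedge≅step k = inj₁ (position-inject₁ k , refl)

  module Colouring (δ : Edge → Color) (wd : WellDefinedColoring δ) where

    edgeIs-colour : ∀ {e a b} → EdgeIs e a b → (p : Adj a b) → δ e ≡ δ (edge a b p)
    edgeIs-colour {e} {a} {b} e≅ab p = sym (wd (edge a b p) e e≅ab)

    flip-colour : ∀ {a b} (p : Adj a b) → δ (edge b a (Adj-sym p)) ≡ δ (edge a b p)
    flip-colour p = wd _ _ (inj₂ (refl , refl))

    cycleColours : (C : Cycle) → Fin (3 + Cycle.len-3 C) → Color
    cycleColours C i = δ (Cycle.cedge C i)

    nac⇒¬lonely : IsNAC δ → (C : Cycle) → ∀ i → ¬ Lonely (cycleColours C) i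
    nac⇒¬lonely (_ , nac) C i lonely = lonely⇒¬nacPattern (cycleColours C) i lonely (nac C)

    nac-triangle : ∀ {a b c} → IsNAC δ → (p : Adj a b) (q : Adj b c) (r : Adj c a) →
                   δ (edge a b p) ≡ δ (edge b c q)
    nac-triangle nac p q r = decidable-stable (_ ≟ᶜ _) λ ab≢bc →
      let i , lonely = lonely-in-triangle (cycleColours C) ab≢bc
      in  nac⇒¬lonely nac C i lonely
      where C = triangle p q r

    nac-triangle-colour : ∀ {a b c e} → IsNAC δ → (p : Adj a b) (q : Adj b c) (r : Adj c a) →
                          EdgeIs e a b ⊎ EdgeIs e b c ⊎ EdgeIs e c a → δ e ≡ δ (edge a b p)
    nac-triangle-colour nac p q r (inj₁ e≅ab)        = edgeIs-colour e≅ab p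
    nac-triangle-colour nac p q r (inj₂ (inj₁ e≅bc)) =
      trans (edgeIs-colour e≅bc q) (sym (nac-triangle nac p q r))
    nac-triangle-colour nac p q r (inj₂ (inj₂ e≅ca)) =
      trans (edgeIs-colour e≅ca r) (sym (trans (nac-triangle nac p q r) (nac-triangle nac q r p)))

    twoEdgePath : ∀ {a b c col} → a ≢ c → (p : Adj a b) (q : Adj b c) →
                  δ (edge a b p) ≡ col → δ (edge b c q) ≡ col → MonoPath δ col a c
    twoEdgePath {a} {b} {c} a≢c p q p-col q-col = record
      { len      = 2
      ; pvtx     = lookup (a ∷ b ∷ c ∷ [])
      ; pvtx-inj = lookup-injective ((adj⇒≢ p ∷ a≢c ∷ []) ∷ (adj⇒≢ q ∷ []) ∷ [] ∷ [])
      ; start    = refl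
      ; end      = refl
      ; padj     = λ where
          zero       → p
          (suc zero) → q
      ; pcolor   = λ where
          zero       → p-col
          (suc zero) → q-col
      }

    cartesian⇒¬twoColouredPaths : ∀ {a c col₁ col₂} → IsCartesian δ → a ≢ c → col₁ ≢ col₂ →
                                  MonoPath δ col₁ a c → MonoPath δ col₂ a c → ⊥
    cartesian⇒¬twoColouredPaths {col₁ = red}  {blue} cart a≢c _ reds  blues = cart _ _ a≢c reds blues
    cartesian⇒¬twoColouredPaths {col₁ = blue} {red}  cart a≢c _ blues reds  = cart _ _ a≢c reds blues
    cartesian⇒¬twoColouredPaths {col₁ = red}  {red}  _    _   ne _ _ = ne refl
    cartesian⇒¬twoColouredPaths {col₁ = blue} {blue} _    _   ne _ _ = ne refl

    cartesianNAC-square : ∀ {a b c d} → IsCartesianNAC δ → a ≢ c → b ≢ d →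
                          (p : Adj a b) (q : Adj b c) (r : Adj c d) (s : Adj d a) →
                          δ (edge a b p) ≡ δ (edge c d r)
    cartesianNAC-square (nac , cart) a≢c b≢d p q r s = decidable-stable (_ ≟ᶜ _) λ ab≢cd →
      case square-colouring (cycleColours C) ab≢cd of λ where
        (inj₁ (i , lonely)) → nac⇒¬lonely nac C i lonely
        (inj₂ (inj₁ (ab≡bc , cd≡da))) → cartesian⇒¬twoColouredPaths cart a≢c ab≢cd
          (twoEdgePath a≢c p q refl (sym ab≡bc))
          (twoEdgePath a≢c (Adj-sym s) (Adj-sym r) (trans (flip-colour s) (sym cd≡da)) (flip-colour r))
        (inj₂ (inj₂ (bc≡cd , da≡ab))) → cartesian⇒¬twoColouredPaths cart b≢d ab≢cd
          (twoEdgePath b≢d (Adj-sym p) (Adj-sym s) (flip-colour p) (trans (flip-colour s) da≡ab))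
          (twoEdgePath b≢d q r bc≡cd refl)
      where C = square a≢c b≢d p q r s

    cartesianNAC⇒angleStep-colour : ∀ {e f} → IsCartesianNAC δ → AngleStep e f → δ e ≡ δ f
    cartesianNAC⇒angleStep-colour {e} {f} _ (inj₁ same) = wd e f same
    cartesianNAC⇒angleStep-colour (nac , _) (inj₂ (inj₁ (_ , _ , _ , p , q , r , e∈abc , f∈abc))) =
      trans (nac-triangle-colour nac p q r e∈abc) (sym (nac-triangle-colour nac p q r f∈abc))
    cartesianNAC⇒angleStep-colour cn
      (inj₂ (inj₂ (_ , _ , _ , _ , _ , a≢c , _ , _ , b≢d , _ , p , q , r , s , inj₁ (e≅ab , f≅cd)))) =
      trans (edgeIs-colour e≅ab p)
            (trans (cartesianNAC-square cn a≢c b≢d p q r s) (sym (edgeIs-colour f≅cd r)))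
    cartesianNAC⇒angleStep-colour cn
      (inj₂ (inj₂ (_ , _ , _ , _ , _ , a≢c , _ , _ , b≢d , _ , p , q , r , s , inj₂ (e≅bc , f≅da)))) =
      trans (edgeIs-colour e≅bc q)
            (trans (cartesianNAC-square cn b≢d (a≢c ∘ sym) q r s p) (sym (edgeIs-colour f≅da s)))

    cartesianNAC⇒monochromatic : IsCartesianNAC δ → AllClassesMonochromatic δ
    cartesianNAC⇒monochromatic cn _ _ =
      Star.fold (λ e f → δ e ≡ δ f) (trans ∘ cartesianNAC⇒angleStep-colour cn) refl

module WalkIndependence (R : CompleteOrderedField) (G : Graph) where
  open GraphNotions G
  open Placements R renaming (yes to inClass; no to notInClass)
  open Graphs G

  -- Its operations unfold definitionally to _+²_, _-²_, 0² and _≈²_ of the plane.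
  ℝ² : AbelianGroup _ _
  ℝ² = DirectProduct.abelianGroup +-abelianGroup +-abelianGroup
    where open CompleteOrderedField R using (+-abelianGroup)

  open AbelianGroup ℝ² using (commutativeMonoid; inverseʳ; identityˡ; ∙-congʳ)
    renaming (sym to ≈²-sym; trans to ≈²-trans)
  open AbelianGroupProperties ℝ² using (x∙y⁻¹≈ε⇒x≈y)

  module _ (ρ : V → Pt) where

    displacement : Edge → Pt
    displacement g = ρ (tgt g) -² ρ (src g)

    open FilteredSums commutativeMonoid displacement public

    total-edges : ∀ {u v} (W : Walk u v) → total (edges W) ≈² (ρ v -² ρ u)
    total-edges {u} []                = ≈²-sym (inverseʳ (ρ u))
    total-edges {u} (_▸_ {v} {w} W a) =
      ≈²-trans (∙-congʳ (total-edges W)) (telescope ℝ² (ρ u) (ρ v) (ρ w))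

    filteredSum⇒classSum : ∀ {e u v s} (W : Walk u v) →
                           FilteredSum (SameClass e) (edges W) s → ClassSum ρ e W s
    filteredSum⇒classSum []      []             = nil
    filteredSum⇒classSum (W ▸ a) (keep e~a sum) = inClass    a (filteredSum⇒classSum W sum) e~a
    filteredSum⇒classSum (W ▸ a) (skip e≁a sum) = notInClass a (filteredSum⇒classSum W sum) e≁a

    pathWalk-classSum-none : ∀ {n e} (f : Fin (1 + n) → V) adj →
                             (∀ k → ¬ SameClass e (pathEdge f adj k)) →
                             ClassSum ρ e (pathWalk f adj) 0²
    pathWalk-classSum-none {ℕ.zero}  f adj _    = nil
    pathWalk-classSum-none {ℕ.suc n} f adj none =
      notInClass (adj (fromℕ n))
                 (pathWalk-classSum-none (f ∘ inject₁) (adj ∘ inject₁) (none ∘ inject₁))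
                 (none (fromℕ n))

    pathWalk-classSum-single : ∀ {n e} (f : Fin (1 + n) → V) adj i →
                               SameClass e (pathEdge f adj i) →
                               (∀ k → k ≢ i → ¬ SameClass e (pathEdge f adj k)) →
                               ClassSum ρ e (pathWalk f adj) (0² +² displacement (pathEdge f adj i))
    pathWalk-classSum-single {ℕ.suc n} f adj i e~i others with lastOrInject i
    ... | last     =
      inClass (adj (fromℕ n))
              (pathWalk-classSum-none (f ∘ inject₁) (adj ∘ inject₁)
                                      λ k → others (inject₁ k) (fromℕ≢inject₁ ∘ sym))
              e~i
    ... | inject j =
      notInClass (adj (fromℕ n))
                 (pathWalk-classSum-single (f ∘ inject₁) (adj ∘ inject₁) j e~i
                                           λ k k≢j → others (inject₁ k) (k≢j ∘ inject₁-injective))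
                 (others (fromℕ n) fromℕ≢inject₁)

  module _ {ρ : V → Pt} (wi : IsWalkIndependent ρ) where

    ρ-injective : ∀ u v → ρ u ≈² ρ v → u ≡ v
    ρ-injective = proj₁ (proj₁ wi)

    classSum-closed : ∀ {e u v s} (W : Walk u v) → v ≡ u → ClassSum ρ e W s → s ≈² 0²
    classSum-closed W refl = proj₂ wi _ _ W _

    displacement≉0 : ∀ g → ¬ displacement ρ g ≈² 0²
    displacement≉0 (edge a b p) disp≈0 =
      Adj-irr (subst (Adj a) (ρ-injective b a (x∙y⁻¹≈ε⇒x≈y _ _ disp≈0)) p)

    closedPath⇒¬uniqueInClass : ∀ {n} (f : Fin (1 + n) → V) adj → f (fromℕ n) ≡ f zero → ∀ i →
                                ¬ (∀ k → k ≢ i → ¬ SameClass (pathEdge f adj i) (pathEdge f adj k))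
    closedPath⇒¬uniqueInClass f adj closes i unique =
      displacement≉0 (pathEdge f adj i)
        (≈²-trans (≈²-sym (identityˡ _))
                  (classSum-closed (pathWalk f adj) closes
                                   (pathWalk-classSum-single ρ f adj i Star.ε unique)))

    module _ (δ : Edge → Color) (wd : WellDefinedColoring δ) (mono : AllClassesMonochromatic δ) where
      open Colouring δ wd

      monochromatic⇒¬lonely : (C : Cycle) → ∀ i → ¬ Lonely (cycleColours C) i
      monochromatic⇒¬lonely C i lonely =
        closedPath⇒¬uniqueInClass position step position-closes i λ k k≢i i~k →
          lonely k k≢i (begin
            δ (cedge k)                  ≡⟨ wd _ _ (cedge≅step k) ⟩
            δ (pathEdge position step k) ≡⟨ mono _ _ i~k ⟨
            δ (pathEdge position step i) ≡⟨ wd _ _ (cedge≅step i) ⟨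
            δ (cedge i)                  ∎)
        where
        open Cycle C
        open CyclePath C
        open ≡-Reasoning

      monochromatic⇒nac : SurjectiveColoring δ → IsNAC δ
      monochromatic⇒nac surjective =
        surjective , λ C → ¬lonely⇒nacPattern (cycleColours C) (monochromatic⇒¬lonely C)

      ColouredWalk : Color → V → V → Set
      ColouredWalk col u v = Σ (Walk u v) λ W → All (λ g → δ g ≡ col) (edges W)

      monoPath⇒colouredWalk : ∀ {col u v} → MonoPath δ col u v → ColouredWalk col u v
      monoPath⇒colouredWalk {col} P =
        subst₂ (ColouredWalk col) start end (pathWalk pvtx padj , All-pathWalk pvtx padj pcolor)
        where open MonoPath P

      reverse-colouredWalk : ∀ {col u v} → ColouredWalk col u v → ColouredWalk col v u
      reverse-colouredWalk (W , colours) =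
        reverseᵂ W , All-reverseᵂ (λ a → trans (flip-colour a)) W colours

      colouredWalks⇒¬¬≡ : ∀ {col₁ col₂ u v} → col₁ ≢ col₂ →
                          ColouredWalk col₁ u v → ColouredWalk col₂ u v → ¬ ¬ (u ≡ v)
      colouredWalks⇒¬¬≡ {col₂ = col₂} col₁≢col₂ (W₁ , colours₁) W₂ u≢v =
        classSumsVanish⇒¬¬total≈ε ρ sameClass-isEquivalence (edges W₁) classSumsVanish
          λ total≈0 → u≢v (sym (ρ-injective _ _
                         (x∙y⁻¹≈ε⇒x≈y _ _ (≈²-trans (≈²-sym (total-edges ρ W₁)) total≈0))))
        where
        W₂⁻ = reverse-colouredWalk W₂
        closed = W₁ ++ᵂ proj₁ W₂⁻

        classSumsVanish : ClassSumsVanish ρ sameClass-isEquivalence (edges W₁)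
        classSumsVanish x∈W₁ sum =
          classSum-closed closed refl (filteredSum⇒classSum ρ closed
            (subst (λ xs → FilteredSum ρ _ xs _) (sym (edges-++ᵂ W₁ (proj₁ W₂⁻)))
                   (filteredSum-skip-++ ρ (All.map (outside-class x∈W₁) (proj₂ W₂⁻)) sum)))
          where
          outside-class : ∀ {x g} → x ∈ edges W₁ → δ g ≡ col₂ → ¬ SameClass x g
          outside-class x∈W₁ g-col x~g =
            col₁≢col₂ (trans (sym (All.lookup colours₁ x∈W₁)) (trans (mono _ _ x~g) g-col))

      monochromatic⇒cartesian : IsCartesian δ
      monochromatic⇒cartesian u v u≢v reds blues =
        colouredWalks⇒¬¬≡ (λ ()) (monoPath⇒colouredWalk reds) (monoPath⇒colouredWalk blues) u≢v

lemma1p13 : (R : CompleteOrderedField) (G : Graph) →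
    let open GraphNotions G in
    let open Placements R in
    (ρ : V → Pt) → IsWalkIndependent ρ →
    (δ : Edge → Color) → WellDefinedColoring δ → SurjectiveColoring δ →
    (IsCartesianNAC δ → AllClassesMonochromatic δ) ×
    (AllClassesMonochromatic δ → IsCartesianNAC δ)
lemma1p13 R G ρ wi δ wd surjective =
    Graphs.Colouring.cartesianNAC⇒monochromatic G δ wd
  , λ mono → monochromatic⇒nac wi δ wd mono surjective , monochromatic⇒cartesian wi δ wd mono
  where open WalkIndependence R G
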